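{- For $n\geq 2$, the number $\kappa_n$ of kernel positions of rank $n$ in the original Bernoulli game satisfies $$\kappa_n=\sum_{i=1}^{n-1}\kappa_i\,(n-i-1)!^2\binom{n}{i+1}\binom{n}{i-1}.$$
   Context: The original Bernoulli game: positions of rank $n\ge1$ are pairs of words $(u_1\cdots u_n, v_1\cdots v_n)$ of positive integers with $1\le u_i,v_i\le i$ for all $i$. A valid move replaces $(u_1\cdots u_n,v_1\cdots v_n)$ by $(u_1\cdots u_m,v_1\cdots v_m)$ for some $1\le m<n$ satisfying $u_{m+1}\le v_j$ for all $j=m+1,\ldots,n$. Players alternate; a player unable to move loses. Kernel positions are positions of Grundy number zero (equivalently, positions from which every valid move leads to a non-kernel position). -}

module Defs where

open import Data.Nat using (ℕ; zero; suc; _+_; _*_; _∸_; _^_; _≤ᵇ_; _⊓_; _!)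
open import Data.Nat.Combinatorics using (_C_)
open import Data.Bool using (Bool; true; false; _∧_; not; if_then_else_)
open import Data.List using (List; []; _∷_; _++_; [_]; map; concatMap; applyUpTo; length; filter; zip; reverse)
open import Data.Nat.ListAction using (sum)
open import Data.Product using (_×_; _,_; proj₁; proj₂)
open import Relation.Nullary.Decidable using (Dec)
open import Data.Bool using (T)
open import Data.Bool.Properties using (T?)

-- A word of length n with letters u_i ∈ {1,…,i}, written in natural order u₁ ⋯ uₙ.
Word : Set
Word = List ℕ

words : ℕ → List Word
words zero    = [] ∷ []
words (suc n) = concatMap (λ w → map (λ a → w ++ [ a ]) (applyUpTo suc (suc n))) (words n)

Position : Set
Position = Word × Word

positions : ℕ → List Position
positions n = concatMap (λ u → map (λ v → (u , v)) (words n)) (words n)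

-- Kernel test on a position given as the REVERSED list of letter pairs
--   (uₙ , vₙ) ∷ (uₙ₋₁ , vₙ₋₁) ∷ ⋯ ∷ (u₁ , v₁).
-- A move to rank m (1 ≤ m < n) drops the first n − m entries of this list;
-- it is valid iff u_{m+1} ≤ v_j for all j = m+1,…,n.
-- A position is a kernel position iff every valid move leads to a non-kernel
-- position (rank 0 never occurs as a target since m ≥ 1).
mutual
  kernelRev : List (ℕ × ℕ) → Bool
  kernelRev []              = true
  kernelRev ((u , v) ∷ xs)  = movesOK v ((u , v) ∷ xs)

  -- movesOK mv ((u , v) ∷ ys): consider the move whose last dropped letter pair is
  -- (u , v) = (u_{m+1} , v_{m+1}), target position ys (of rank m);
  -- mv is the minimum of the v_j already dropped (j > m+1), or v itself initially.
  movesOK : ℕ → List (ℕ × ℕ) → Bool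
  movesOK mv []             = true
  movesOK mv ((u , v) ∷ ys) =
    (if (u ≤ᵇ (mv ⊓ v)) then targetNonKernel ys else true) ∧ movesOK (mv ⊓ v) ys

  targetNonKernel : List (ℕ × ℕ) → Bool
  targetNonKernel []       = true   -- m = 0 is not a legal move
  targetNonKernel (y ∷ ys) = not (kernelRev (y ∷ ys))

isKernel : Position → Bool
isKernel (u , v) = kernelRev (reverse (zip u v))

κ : ℕ → ℕ
κ n = length (filter (λ p → T? (isKernel p)) (positions n))

rhs : ℕ → ℕ
rhs n = sum (map (λ i → κ i * (((n ∸ i ∸ 1) !) ^ 2) * (n C (i + 1)) * (n C (i ∸ 1)))
                 (applyUpTo suc (n ∸ 1)))

module Submission where

-- 1. Reading a position from rank 1 upwards, its kernel status is computed by an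
--    automaton with states "kernel" and "threshold t".  A non-kernel position
--    with threshold t extended by a letter pair (u , v) stays non-kernel iff
--    t ≤ v; a kernel position extended by (u , v) becomes non-kernel, with
--    threshold u, iff u ≤ v.  This is the only place where the game is used.
-- 2. A sum of weights F(state) over all positions of rank n+1 is the sum over
--    rank n of a "transfer" of F.  At rank ≥ 1 only kernel and threshold states
--    occur, so such a sum splits into a multiple of κ and a sum over
--    threshold states.
-- 3. Unrolling the threshold part writes κₙ as Σᵢ κᵢ times a coefficient made of
--    rising products; absorption and hockey-stick identities for binomial
--    coefficients evaluate it to (n-i-1)!² C(n,i+1) C(n,i-1).

open import Defs
open import Data.Nat using (ℕ; zero; suc; _+_; _*_; _∸_; _^_; _≤_; _<_; z≤n; s≤s; _≤ᵇ_; _⊓_; _!)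
open import Data.Nat.Properties
open import Data.Nat.Combinatorics
  using (_C_; nCk≡n!/k![n-k]!; k![n∸k]!∣n!; nCk+nC[k+1]≡[n+1]C[k+1]; nCn≡1; nC1≡n; k>n⇒nCk≡0; nCk≡nC[n∸k])
open import Data.Nat.DivMod using (m/n*n≡m)
open import Data.Nat.ListAction using (sum)
open import Data.Nat.Tactic.RingSolver using (solve-∀)
open import Data.Bool using (Bool; true; false; not; if_then_else_; _∧_)
open import Data.Bool.Properties using (T?; if-float; if-eta)
open import Data.List using (List; []; _∷_; _++_; [_]; map; concatMap; applyUpTo; length; filter; zip; reverse)
open import Data.List.Properties using (length-++; reverse-++)
open import Data.Product using (_×_; _,_; proj₁)
open import Data.Unit using (tt)
open import Data.Empty using (⊥-elim)
open import Relation.Nullary using (¬_; yes; no)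
open import Relation.Binary.PropositionalEquality hiding ([_])
open ≡-Reasoning

sumOver : {A : Set} → List A → (A → ℕ) → ℕ
sumOver L f = sum (map f L)

sumOver-cong : {A : Set} (L : List A) {f g : A → ℕ} → (∀ x → f x ≡ g x) → sumOver L f ≡ sumOver L g
sumOver-cong []      eq = refl
sumOver-cong (x ∷ L) eq = cong₂ _+_ (eq x) (sumOver-cong L eq)

sumOver-zero : {A : Set} (L : List A) → sumOver L (λ _ → 0) ≡ 0
sumOver-zero []      = refl
sumOver-zero (_ ∷ L) = sumOver-zero L

sumOver-+ : {A : Set} (L : List A) (f g : A → ℕ) → sumOver L (λ x → f x + g x) ≡ sumOver L f + sumOver L g
sumOver-+ []      f g = refl
sumOver-+ (x ∷ L) f g =
  trans (cong (f x + g x +_) (sumOver-+ L f g)) (interchange (f x) (g x) (sumOver L f) (sumOver L g))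
  where
  interchange : ∀ a b c d → a + b + (c + d) ≡ a + c + (b + d)
  interchange = solve-∀

sumOver-* : {A : Set} (L : List A) (c : ℕ) (f : A → ℕ) → sumOver L (λ x → c * f x) ≡ c * sumOver L f
sumOver-* []      c f = sym (*-zeroʳ c)
sumOver-* (x ∷ L) c f = trans (cong (c * f x +_) (sumOver-* L c f)) (sym (*-distribˡ-+ c (f x) _))

sumOver-++ : {A : Set} (L M : List A) (f : A → ℕ) → sumOver (L ++ M) f ≡ sumOver L f + sumOver M f
sumOver-++ []      M f = refl
sumOver-++ (x ∷ L) M f = trans (cong (f x +_) (sumOver-++ L M f)) (sym (+-assoc (f x) _ _))

sumOver-concatMap : {A B : Set} (G : A → List B) (L : List A) (f : B → ℕ) →
                    sumOver (concatMap G L) f ≡ sumOver L (λ x → sumOver (G x) f)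
sumOver-concatMap G []      f = refl
sumOver-concatMap G (x ∷ L) f =
  trans (sumOver-++ (G x) (concatMap G L) f) (cong (sumOver (G x) f +_) (sumOver-concatMap G L f))

sumOver-map : {A B : Set} (h : A → B) (L : List A) (f : B → ℕ) → sumOver (map h L) f ≡ sumOver L (λ x → f (h x))
sumOver-map h []      f = refl
sumOver-map h (x ∷ L) f = cong (f (h x) +_) (sumOver-map h L f)

sumBelow : ℕ → (ℕ → ℕ) → ℕ
sumBelow zero    f = 0
sumBelow (suc k) f = sumBelow k f + f k

sumBelow-shift : ∀ k f → sumBelow (suc k) f ≡ f 0 + sumBelow k (λ j → f (suc j))
sumBelow-shift zero    f = +-comm 0 (f 0)
sumBelow-shift (suc k) f =
  trans (cong (_+ f (suc k)) (sumBelow-shift k f)) (+-assoc (f 0) _ _)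

sumBelow-cong : ∀ k {f g : ℕ → ℕ} → (∀ j → j < k → f j ≡ g j) → sumBelow k f ≡ sumBelow k g
sumBelow-cong zero    eq = refl
sumBelow-cong (suc k) eq = cong₂ _+_ (sumBelow-cong k (λ j j<k → eq j (m<n⇒m<1+n j<k))) (eq k ≤-refl)

sumBelow-cong′ : ∀ k {f g : ℕ → ℕ} → (∀ j → f j ≡ g j) → sumBelow k f ≡ sumBelow k g
sumBelow-cong′ k eq = sumBelow-cong k (λ j _ → eq j)

sumBelow-+ : ∀ k f g → sumBelow k (λ j → f j + g j) ≡ sumBelow k f + sumBelow k g
sumBelow-+ zero    f g = refl
sumBelow-+ (suc k) f g =
  trans (cong (_+ (f k + g k)) (sumBelow-+ k f g)) (interchange (sumBelow k f) (sumBelow k g) (f k) (g k))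
  where
  interchange : ∀ a b c d → a + b + (c + d) ≡ a + c + (b + d)
  interchange = solve-∀

sumBelow-* : ∀ k c f → sumBelow k (λ j → c * f j) ≡ c * sumBelow k f
sumBelow-* zero    c f = sym (*-zeroʳ c)
sumBelow-* (suc k) c f = trans (cong (_+ c * f k) (sumBelow-* k c f)) (sym (*-distribˡ-+ c (sumBelow k f) (f k)))

sumBelow-const : ∀ k c → sumBelow k (λ _ → c) ≡ k * c
sumBelow-const zero    c = refl
sumBelow-const (suc k) c = trans (cong (_+ c) (sumBelow-const k c)) (+-comm (k * c) c)

sumBelow-reverse : ∀ k f → sumBelow k f ≡ sumBelow k (λ c → f (k ∸ suc c))
sumBelow-reverse zero    f = refl
sumBelow-reverse (suc k) f = begin
  sumBelow k f + f k                            ≡⟨ +-comm (sumBelow k f) (f k) ⟩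
  f k + sumBelow k f                            ≡⟨ cong (f k +_) (sumBelow-reverse k f) ⟩
  f k + sumBelow k (λ c → f (k ∸ suc c))        ≡⟨ sym (sumBelow-shift k (λ c → f (suc k ∸ suc c))) ⟩
  sumBelow (suc k) (λ c → f (suc k ∸ suc c))    ∎

sumBelow-sumOver : {A : Set} (k : ℕ) (L : List A) (f : ℕ → A → ℕ) →
                   sumBelow k (λ a → sumOver L (f a)) ≡ sumOver L (λ x → sumBelow k (λ a → f a x))
sumBelow-sumOver zero    L f = sym (sumOver-zero L)
sumBelow-sumOver (suc k) L f =
  trans (cong (_+ sumOver L (f k)) (sumBelow-sumOver k L f)) (sym (sumOver-+ L (λ x → sumBelow k (λ a → f a x)) (f k)))

sumOver-applyUpTo : ∀ k (g f : ℕ → ℕ) → sumOver (applyUpTo g k) f ≡ sumBelow k (λ j → f (g j))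
sumOver-applyUpTo zero    g f = refl
sumOver-applyUpTo (suc k) g f =
  trans (cong (f (g 0) +_) (sumOver-applyUpTo k (λ j → g (suc j)) f)) (sym (sumBelow-shift k (λ j → f (g j))))

≤ᵇ-true : ∀ {c k} → c ≤ k → (c ≤ᵇ k) ≡ true
≤ᵇ-true {c} {k} c≤k with c ≤ᵇ k | ≤⇒≤ᵇ c≤k
... | true | _ = refl

≤ᵇ-false : ∀ {c k} → ¬ (c ≤ k) → (c ≤ᵇ k) ≡ false
≤ᵇ-false {c} {k} c≰k with c ≤ᵇ k | ≤ᵇ⇒≤ c k
... | false | _       = refl
... | true  | reflect = ⊥-elim (c≰k (reflect tt))

sumBelow-threshold : ∀ k c x y → sumBelow k (λ b → if c ≤ᵇ b then x else y) ≡ (c ⊓ k) * y + (k ∸ c) * x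
sumBelow-threshold zero    zero    x y = refl
sumBelow-threshold zero    (suc c) x y = refl
sumBelow-threshold (suc k) c x y with c ≤? k
... | yes c≤k
  rewrite ≤ᵇ-true c≤k | sumBelow-threshold k c x y | m≤n⇒m⊓n≡m c≤k
        | m≤n⇒m⊓n≡m (m≤n⇒m≤1+n c≤k) | +-∸-assoc 1 c≤k =
  trans (+-assoc (c * y) _ x) (cong (c * y +_) (+-comm ((k ∸ c) * x) x))
... | no c≰k
  rewrite ≤ᵇ-false c≰k | sumBelow-threshold k c x y | m≥n⇒m⊓n≡n (≰⇒≥ c≰k) | m≥n⇒m⊓n≡n (≰⇒> c≰k)
        | m≤n⇒m∸n≡0 (≰⇒≥ c≰k) | m≤n⇒m∸n≡0 (≰⇒> c≰k) =
  trans (cong (_+ y) (+-identityʳ (k * y))) (trans (+-comm (k * y) y) (sym (+-identityʳ (y + k * y))))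

sumWords-suc : ∀ n (f : Word → ℕ) →
               sumOver (words (suc n)) f ≡ sumOver (words n) (λ w → sumBelow (suc n) (λ a → f (w ++ [ suc a ])))
sumWords-suc n f = trans (sumOver-concatMap _ (words n) f) (sumOver-cong (words n) (λ w →
  trans (sumOver-map (λ a → w ++ [ a ]) (applyUpTo suc (suc n)) f) (sumOver-applyUpTo (suc n) suc (λ a → f (w ++ [ a ])))))

sumWords-cong : ∀ n {f g : Word → ℕ} → (∀ w → length w ≡ n → f w ≡ g w) → sumOver (words n) f ≡ sumOver (words n) g
sumWords-cong zero    eq = cong (_+ 0) (eq [] refl)
sumWords-cong (suc n) {f} {g} eq = begin
  sumOver (words (suc n)) f                                           ≡⟨ sumWords-suc n f ⟩
  sumOver (words n) (λ w → sumBelow (suc n) (λ a → f (w ++ [ suc a ]))) ≡⟨ sumWords-cong n (λ w ∣w∣ →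
                                                                           sumBelow-cong′ (suc n) (λ a → eq _ (length-snoc w ∣w∣))) ⟩
  sumOver (words n) (λ w → sumBelow (suc n) (λ a → g (w ++ [ suc a ]))) ≡⟨ sym (sumWords-suc n g) ⟩
  sumOver (words (suc n)) g                                           ∎
  where
  length-snoc : ∀ w {a} → length w ≡ n → length (w ++ [ a ]) ≡ suc n
  length-snoc w ∣w∣ = trans (length-++ w) (trans (cong (_+ 1) ∣w∣) (+-comm n 1))

zip-snoc : ∀ (u v : List ℕ) a b → length u ≡ length v → zip (u ++ [ a ]) (v ++ [ b ]) ≡ zip u v ++ [ (a , b) ]
zip-snoc []      []      a b _ = refl
zip-snoc (x ∷ u) (y ∷ v) a b p = cong ((x , y) ∷_) (zip-snoc u v a b (suc-injective p))

-- Σ over positions (u , v) of rank n of g applied to the reversed list of letter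
-- pairs (uₙ , vₙ) ∷ ⋯ ∷ (u₁ , v₁), the form read by the kernel test.
sumPositions : ℕ → (List (ℕ × ℕ) → ℕ) → ℕ
sumPositions n g = sumOver (words n) (λ u → sumOver (words n) (λ v → g (reverse (zip u v))))

sumPositions-suc : ∀ n g → sumPositions (suc n) g
                         ≡ sumPositions n (λ r → sumBelow (suc n) (λ a → sumBelow (suc n) (λ b → g ((suc a , suc b) ∷ r))))
sumPositions-suc n g = begin
  sumPositions (suc n) g
    ≡⟨ sumWords-suc n _ ⟩
  sumOver W (λ u → sumBelow N (λ a → sumOver (words (suc n)) (λ v → g (reverse (zip (u ++ [ suc a ]) v)))))
    ≡⟨ sumOver-cong W (λ u → sumBelow-cong′ N (λ a → sumWords-suc n _)) ⟩
  sumOver W (λ u → sumBelow N (λ a → sumOver W (λ v → sumBelow N (λ b → g (reverse (zip (u ++ [ suc a ]) (v ++ [ suc b ])))))))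
    ≡⟨ sumWords-cong n (λ u ∣u∣ → sumBelow-cong′ N (λ a → sumWords-cong n (λ v ∣v∣ → sumBelow-cong′ N (λ b →
         cong g (trans (cong reverse (zip-snoc u v _ _ (trans ∣u∣ (sym ∣v∣)))) (reverse-++ (zip u v) _)))))) ⟩
  sumOver W (λ u → sumBelow N (λ a → sumOver W (λ v → sumBelow N (λ b → g ((suc a , suc b) ∷ reverse (zip u v))))))
    ≡⟨ sumOver-cong W (λ u → sumBelow-sumOver N W _) ⟩
  sumPositions n (λ r → sumBelow N (λ a → sumBelow N (λ b → g ((suc a , suc b) ∷ r)))) ∎
  where
  W = words n
  N = suc n

sumPositions-cong : ∀ n {f g} → (∀ r → f r ≡ g r) → sumPositions n f ≡ sumPositions n g
sumPositions-cong n eq = sumOver-cong (words n) (λ u → sumOver-cong (words n) (λ v → eq _))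

sumPositions-+ : ∀ n f g → sumPositions n (λ r → f r + g r) ≡ sumPositions n f + sumPositions n g
sumPositions-+ n f g = trans (sumOver-cong (words n) (λ u → sumOver-+ (words n) _ _)) (sumOver-+ (words n) _ _)

sumPositions-* : ∀ n c f → sumPositions n (λ r → c * f r) ≡ c * sumPositions n f
sumPositions-* n c f = trans (sumOver-cong (words n) (λ u → sumOver-* (words n) c _)) (sumOver-* (words n) c _)

-- start: the empty position; kernel: a kernel position; threshold t: a
-- non-kernel position whose extensions by (u , v) are non-kernel iff t ≤ v.
data State : Set where
  start     : State
  kernel    : State
  threshold : ℕ → State

step : State → ℕ × ℕ → State
step start         _       = kernel
step kernel        (u , v) = if u ≤ᵇ v then threshold u else kernel
step (threshold t) (u , v) = if t ≤ᵇ v then threshold t else kernel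

state : List (ℕ × ℕ) → State
state []       = start
state (x ∷ xs) = step (state xs) x

isKernelState : State → Bool
isKernelState (threshold _) = false
isKernelState _             = true

-- Value of  movesOK mv  predicted by the state: from a threshold-t position the
-- moves considered by movesOK reach a kernel position iff t ≤ mv.
noKernelMove : State → ℕ → Bool
noKernelMove (threshold t) mv = not (t ≤ᵇ mv)
noKernelMove _             _  = true

movesRound : Bool → Bool → Bool → Bool
movesRound legal targetKernel rest = (if legal then not targetKernel else true) ∧ rest

private
  ≰-⊓ˡ : ∀ {a b} c → ¬ (a ≤ b) → ¬ (a ≤ b ⊓ c)
  ≰-⊓ˡ c a≰b a≤b⊓c = a≰b (≤-trans a≤b⊓c (m⊓n≤m _ c))

  ≰-⊓ʳ : ∀ {a b} c → ¬ (a ≤ b) → ¬ (a ≤ c ⊓ b)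
  ≰-⊓ʳ c a≰b a≤c⊓b = a≰b (≤-trans a≤c⊓b (m⊓n≤n c _))

movesRound-kernel : ∀ u v mv → movesRound (u ≤ᵇ mv ⊓ v) true true ≡ noKernelMove (step kernel (u , v)) mv
movesRound-kernel u v mv with u ≤? v | u ≤? mv
... | yes u≤v | yes u≤mv rewrite ≤ᵇ-true u≤v | ≤ᵇ-true u≤mv | ≤ᵇ-true (⊓-glb u≤mv u≤v) = refl
... | yes u≤v | no  u≰mv rewrite ≤ᵇ-true u≤v | ≤ᵇ-false u≰mv | ≤ᵇ-false (≰-⊓ˡ v u≰mv) = refl
... | no  u≰v | _        rewrite ≤ᵇ-false u≰v | ≤ᵇ-false (≰-⊓ʳ mv u≰v) = refl

movesRound-threshold : ∀ t u v mv →
  movesRound (u ≤ᵇ mv ⊓ v) false (noKernelMove (threshold t) (mv ⊓ v)) ≡ noKernelMove (step (threshold t) (u , v)) mv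
movesRound-threshold t u v mv rewrite if-eta (u ≤ᵇ mv ⊓ v) {true} with t ≤? v | t ≤? mv
... | yes t≤v | yes t≤mv rewrite ≤ᵇ-true t≤v | ≤ᵇ-true t≤mv | ≤ᵇ-true (⊓-glb t≤mv t≤v) = refl
... | yes t≤v | no  t≰mv rewrite ≤ᵇ-true t≤v | ≤ᵇ-false t≰mv | ≤ᵇ-false (≰-⊓ˡ v t≰mv) = refl
... | no  t≰v | _        rewrite ≤ᵇ-false t≰v | ≤ᵇ-false (≰-⊓ʳ mv t≰v) = refl

-- After at least one step the state is kernel or threshold, so the two cases above suffice.
movesRound-step : ∀ s y u v mv →
  movesRound (u ≤ᵇ mv ⊓ v) (isKernelState (step s y)) (noKernelMove (step s y) (mv ⊓ v))
  ≡ noKernelMove (step (step s y) (u , v)) mv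
movesRound-step start         y       u v mv = movesRound-kernel u v mv
movesRound-step kernel        (a , b) u v mv with a ≤ᵇ b
... | true  = movesRound-threshold a u v mv
... | false = movesRound-kernel u v mv
movesRound-step (threshold t) (a , b) u v mv with t ≤ᵇ b
... | true  = movesRound-threshold t u v mv
... | false = movesRound-kernel u v mv

noKernelMove-top : ∀ s u v → noKernelMove (step s (u , v)) v ≡ isKernelState (step s (u , v))
noKernelMove-top start         u v = refl
noKernelMove-top kernel        u v with u ≤ᵇ v in eq
... | true  rewrite eq = refl
... | false = refl
noKernelMove-top (threshold t) u v with t ≤ᵇ v in eq
... | true  rewrite eq = refl
... | false = refl

automaton-correct : ∀ xs → (kernelRev xs ≡ isKernelState (state xs)) × (∀ mv → movesOK mv xs ≡ noKernelMove (state xs) mv)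
automaton-correct []                = refl , λ _ → refl
automaton-correct ((u , v) ∷ [])    = rank1 v , rank1
  where
  rank1 : ∀ mv → movesOK mv ((u , v) ∷ []) ≡ true
  rank1 mv = cong (_∧ true) (if-eta (u ≤ᵇ mv ⊓ v))
automaton-correct ((u , v) ∷ y ∷ ys) with automaton-correct (y ∷ ys)
... | kernel-ok , moves-ok = trans (moves v) (noKernelMove-top (state (y ∷ ys)) u v) , moves
  where
  moves : ∀ mv → movesOK mv ((u , v) ∷ y ∷ ys) ≡ noKernelMove (state ((u , v) ∷ y ∷ ys)) mv
  moves mv = trans (cong₂ (movesRound (u ≤ᵇ mv ⊓ v)) kernel-ok (moves-ok (mv ⊓ v))) (movesRound-step (state ys) y u v mv)

stateSum : ℕ → (State → ℕ) → ℕ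
stateSum n F = sumPositions n (λ r → F (state r))

transfer : ℕ → (State → ℕ) → State → ℕ
transfer M F s = sumBelow M (λ a → sumBelow M (λ b → F (step s (suc a , suc b))))

stateSum-suc : ∀ n F → stateSum (suc n) F ≡ stateSum n (transfer (suc n) F)
stateSum-suc n F = sumPositions-suc n (λ r → F (state r))

kernelIndicator : State → ℕ
kernelIndicator s = if isKernelState s then 1 else 0

onThreshold : (ℕ → ℕ) → State → ℕ
onThreshold w (threshold t) = w t
onThreshold w _             = 0

thresholdSum : ℕ → (ℕ → ℕ) → ℕ
thresholdSum n w = stateSum n (onThreshold w)

length-filter : {A : Set} (L : List A) (f : A → Bool) →
                length (filter (λ p → T? (f p)) L) ≡ sumOver L (λ p → if f p then 1 else 0)
length-filter []      f = refl
length-filter (x ∷ L) f with f x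
... | true  = cong suc (length-filter L f)
... | false = length-filter L f

κ-stateSum : ∀ n → κ n ≡ stateSum n kernelIndicator
κ-stateSum n = begin
  κ n                                                       ≡⟨ length-filter (positions n) isKernel ⟩
  sumOver (positions n) indicator                           ≡⟨ sumOver-concatMap _ (words n) indicator ⟩
  sumOver (words n) (λ u → sumOver (map (u ,_) (words n)) indicator)
                                                            ≡⟨ sumOver-cong (words n) (λ u → sumOver-map _ (words n) indicator) ⟩
  sumPositions n (λ r → if kernelRev r then 1 else 0)       ≡⟨ sumPositions-cong n (λ r →
                                                                 cong (λ b → if b then 1 else 0) (proj₁ (automaton-correct r))) ⟩
  stateSum n kernelIndicator                                ∎
  where
  indicator = λ p → if isKernel p then 1 else 0

-- Weights agreeing on kernel and threshold states agree after any step,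
-- since a step never leads to the start state.
step-agree : ∀ (F G : State → ℕ) → F kernel ≡ G kernel → (∀ t → F (threshold t) ≡ G (threshold t)) →
             ∀ s y → F (step s y) ≡ G (step s y)
step-agree F G eqk eqt start         y = eqk
step-agree F G eqk eqt kernel        (u , v) with u ≤ᵇ v
... | true  = eqt u
... | false = eqk
step-agree F G eqk eqt (threshold t) (u , v) with t ≤ᵇ v
... | true  = eqt t
... | false = eqk

stateSum-agree : ∀ n (F G : State → ℕ) → F kernel ≡ G kernel → (∀ t → F (threshold t) ≡ G (threshold t)) →
                 stateSum (suc n) F ≡ stateSum (suc n) G
stateSum-agree n F G eqk eqt =
  trans (stateSum-suc n F) (trans (sumPositions-cong n (λ r → sumBelow-cong′ (suc n) (λ a → sumBelow-cong′ (suc n) (λ b →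
        step-agree F G eqk eqt (state r) _)))) (sym (stateSum-suc n G)))

stateSum-split : ∀ n F → stateSum (suc (suc n)) F
               ≡ transfer (suc (suc n)) F kernel * κ (suc n) + thresholdSum (suc n) (λ t → transfer (suc (suc n)) F (threshold t))
stateSum-split n F = begin
  stateSum (suc (suc n)) F
    ≡⟨ stateSum-suc (suc n) F ⟩
  stateSum (suc n) (transfer M F)
    ≡⟨ stateSum-agree n (transfer M F) split (sym (trans (+-identityʳ (c * 1)) (*-identityʳ c)))
                                             (λ t → sym (cong (_+ w t) (*-zeroʳ c))) ⟩
  stateSum (suc n) split
    ≡⟨ sumPositions-+ (suc n) (λ r → c * kernelIndicator (state r)) (λ r → onThreshold w (state r)) ⟩
  stateSum (suc n) (λ s → c * kernelIndicator s) + thresholdSum (suc n) w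
    ≡⟨ cong (_+ thresholdSum (suc n) w) (sumPositions-* (suc n) c (λ r → kernelIndicator (state r))) ⟩
  c * stateSum (suc n) kernelIndicator + thresholdSum (suc n) w
    ≡⟨ cong (λ k → c * k + thresholdSum (suc n) w) (sym (κ-stateSum (suc n))) ⟩
  c * κ (suc n) + thresholdSum (suc n) w ∎
  where
  M = suc (suc n)
  c = transfer M F kernel
  w = λ t → transfer M F (threshold t)
  split = λ s → c * kernelIndicator s + onThreshold w s

≤ᵇ-suc : ∀ a b → (suc a ≤ᵇ suc b) ≡ (a ≤ᵇ b)
≤ᵇ-suc zero    b = refl
≤ᵇ-suc (suc a) b = refl

if-step : ∀ (F : State → ℕ) s t b → F (if suc t ≤ᵇ suc b then threshold (suc t) else s)
                                   ≡ (if t ≤ᵇ b then F (threshold (suc t)) else F s)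
if-step F s t b = trans (if-float F (suc t ≤ᵇ suc b)) (cong (λ c → if c then F (threshold (suc t)) else F s) (≤ᵇ-suc t b))

-- Explicit transfer: a threshold-(t+1) state keeps its threshold for M ∸ t values
-- of b and becomes kernel for the other t ⊓ M values, whatever a is.
transfer-threshold : ∀ M (F : State → ℕ) t →
  transfer M F (threshold (suc t)) ≡ M * ((t ⊓ M) * F kernel + (M ∸ t) * F (threshold (suc t)))
transfer-threshold M F t =
  trans (sumBelow-cong′ M (λ a → trans (sumBelow-cong′ M (λ b → if-step F kernel t b))
                                       (sumBelow-threshold M t _ _)))
        (sumBelow-const M _)

-- A kernel state extended by (a+1 , b+1) gets threshold a+1 iff a ≤ b.
transfer-kernel : ∀ M (F : State → ℕ) →
  transfer M F kernel ≡ sumBelow M (λ a → (a ⊓ M) * F kernel + (M ∸ a) * F (threshold (suc a)))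
transfer-kernel M F =
  sumBelow-cong′ M (λ a → trans (sumBelow-cong′ M (λ b → if-step F kernel a b)) (sumBelow-threshold M a _ _))

-- α i d = (i+2)(i+3)⋯(i+d+1)  and  β i d t = (i+1-t)(i+2-t)⋯(i+d+1-t):
-- the factors picked up by a threshold t+1 during d steps after it was created.
α : ℕ → ℕ → ℕ
α i zero    = 1
α i (suc d) = suc (suc (i + d)) * α i d

β : ℕ → ℕ → ℕ → ℕ
β i zero    t = suc i ∸ t
β i (suc d) t = (suc (suc (i + d)) ∸ t) * β i d t

-- Contribution of one kernel position of rank i, followed by d+1 further steps,
-- to a threshold sum with weight w.
contribution : ℕ → ℕ → (ℕ → ℕ) → ℕ
contribution i d w = sumBelow (suc i) (λ t → α i d * β i d t * w (suc t))

-- One further step multiplies α by N and β by N ∸ t (the thresholds that survive).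
contribution-step : ∀ i d w →
  contribution i d (λ t → transfer (suc (suc (i + d))) (onThreshold w) (threshold t)) ≡ contribution i (suc d) w
contribution-step i d w = sumBelow-cong′ (suc i) (λ t →
  trans (cong (α i d * β i d t *_) (transfer-threshold N (onThreshold w) t))
        (regroup (α i d) (β i d t) N (t ⊓ N) (N ∸ t) (w (suc t))))
  where
  N = suc (suc (i + d))
  regroup : ∀ a b n p q x → a * b * (n * (p * 0 + q * x)) ≡ n * a * (q * b) * x
  regroup = solve-∀

thresholdSum-unrolled : ∀ m w → thresholdSum (suc m) w ≡ sumBelow m (λ j → κ (suc j) * contribution (suc j) (m ∸ suc j) w)
thresholdSum-unrolled zero    w = refl
thresholdSum-unrolled (suc m) w = begin
  thresholdSum (suc (suc m)) w
    ≡⟨ stateSum-split m (onThreshold w) ⟩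
  transfer M (onThreshold w) kernel * κ (suc m) + thresholdSum (suc m) w′
    ≡⟨ cong₂ _+_ newest (thresholdSum-unrolled m w′) ⟩
  κ (suc m) * contribution (suc m) (m ∸ m) w + sumBelow m (λ j → κ (suc j) * contribution (suc j) (m ∸ suc j) w′)
    ≡⟨ +-comm (κ (suc m) * contribution (suc m) (m ∸ m) w) _ ⟩
  sumBelow m (λ j → κ (suc j) * contribution (suc j) (m ∸ suc j) w′) + κ (suc m) * contribution (suc m) (m ∸ m) w
    ≡⟨ cong (_+ κ (suc m) * contribution (suc m) (m ∸ m) w) (sumBelow-cong m (λ j j<m → cong (κ (suc j) *_) (older j j<m))) ⟩
  sumBelow (suc m) (λ j → κ (suc j) * contribution (suc j) (suc m ∸ suc j) w) ∎
  where
  M = suc (suc m)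
  w′ = λ t → transfer M (onThreshold w) (threshold t)
  newest : transfer M (onThreshold w) kernel * κ (suc m) ≡ κ (suc m) * contribution (suc m) (m ∸ m) w
  newest = begin
    transfer M (onThreshold w) kernel * κ (suc m)
      ≡⟨ *-comm _ (κ (suc m)) ⟩
    κ (suc m) * transfer M (onThreshold w) kernel
      ≡⟨ cong (κ (suc m) *_) (transfer-kernel M (onThreshold w)) ⟩
    κ (suc m) * sumBelow M (λ a → (a ⊓ M) * 0 + (M ∸ a) * w (suc a))
      ≡⟨ cong (κ (suc m) *_) (sumBelow-cong′ M (λ a → drop-kernel (a ⊓ M) (M ∸ a) (w (suc a)))) ⟩
    κ (suc m) * contribution (suc m) 0 w
      ≡⟨ cong (λ d → κ (suc m) * contribution (suc m) d w) (sym (n∸n≡0 m)) ⟩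
    κ (suc m) * contribution (suc m) (m ∸ m) w ∎
    where
    drop-kernel : ∀ p q x → p * 0 + q * x ≡ 1 * q * x
    drop-kernel = solve-∀
  older : ∀ j → j < m → contribution (suc j) (m ∸ suc j) w′ ≡ contribution (suc j) (m ∸ j) w
  older j j<m =
    trans (cong (λ z → contribution (suc j) (m ∸ suc j) (λ t → transfer (suc (suc z)) (onThreshold w) (threshold t)))
                (sym (m+[n∸m]≡n j<m)))
          (trans (contribution-step (suc j) (m ∸ suc j) w) (cong (λ d → contribution (suc j) d w) (sym (+-∸-assoc 1 j<m))))

binomial-factorials : ∀ {n k} → k ≤ n → (n C k) * (k ! * (n ∸ k) !) ≡ n !
binomial-factorials {n} {k} k≤n =
  trans (cong (_* (k ! * (n ∸ k) !)) (nCk≡n!/k![n-k]! k≤n)) (m/n*n≡m {{k !* (n ∸ k) !≢0}} (k![n∸k]!∣n! k≤n))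

absorption : ∀ n k → suc n * (n C k) ≡ suc k * (suc n C suc k)
absorption n k with k ≤? n
... | yes k≤n = *-cancelʳ-≡ (suc n * (n C k)) (suc k * (suc n C suc k)) (k ! * (n ∸ k) !) {{k !* (n ∸ k) !≢0}} (begin
    suc n * (n C k) * (k ! * (n ∸ k) !)        ≡⟨ *-assoc (suc n) (n C k) (k ! * (n ∸ k) !) ⟩
    suc n * ((n C k) * (k ! * (n ∸ k) !))      ≡⟨ cong (suc n *_) (binomial-factorials k≤n) ⟩
    suc n * n !                                ≡⟨ sym (binomial-factorials (s≤s k≤n)) ⟩
    (suc n C suc k) * (suc k ! * (n ∸ k) !)    ≡⟨ regroup (suc n C suc k) (suc k) (k !) ((n ∸ k) !) ⟩
    suc k * (suc n C suc k) * (k ! * (n ∸ k) !) ∎)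
  where
  regroup : ∀ a b c d → a * (b * c * d) ≡ b * a * (c * d)
  regroup = solve-∀
... | no k≰n rewrite k>n⇒nCk≡0 (≰⇒> k≰n) | k>n⇒nCk≡0 (s≤s (≰⇒> k≰n)) = trans (*-zeroʳ (suc n)) (sym (*-zeroʳ (suc k)))

triangular : ∀ k → sumBelow k (λ a → a) ≡ k C 2
triangular zero    = refl
triangular (suc k) =
  trans (cong (_+ k) (triangular k))
        (trans (+-comm (k C 2) k) (trans (cong (_+ k C 2) (sym (nC1≡n k))) (nCk+nC[k+1]≡[n+1]C[k+1] k 1)))

hockey-stick : ∀ i L → sumBelow (suc i) (λ c → (c + L) C L) ≡ suc (i + L) C suc L
hockey-stick zero    L = trans (nCn≡1 L) (sym (nCn≡1 (suc L)))
hockey-stick (suc i) L =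
  trans (cong (_+ (suc (i + L) C L)) (hockey-stick i L))
        (trans (+-comm (suc (i + L) C suc L) (suc (i + L) C L)) (nCk+nC[k+1]≡[n+1]C[k+1] (suc (i + L)) L))

weighted-hockey-stick : ∀ i L → sumBelow (suc i) (λ c → (i ∸ c) * ((c + L) C L)) ≡ suc (i + L) C suc (suc L)
weighted-hockey-stick zero    L = sym (k>n⇒nCk≡0 (s≤s (n<1+n L)))
weighted-hockey-stick (suc i) L = begin
  sumBelow (suc i) (λ c → (suc i ∸ c) * ((c + L) C L)) + (suc i ∸ suc i) * ((suc i + L) C L)
    ≡⟨ cong₂ _+_ (sumBelow-cong (suc i) (λ c c≤i → cong (_* ((c + L) C L)) (+-∸-assoc 1 (≤-pred c≤i))))
                 (cong (_* ((suc i + L) C L)) (n∸n≡0 i)) ⟩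
  sumBelow (suc i) (λ c → (c + L) C L + (i ∸ c) * ((c + L) C L)) + 0
    ≡⟨ +-identityʳ _ ⟩
  sumBelow (suc i) (λ c → (c + L) C L + (i ∸ c) * ((c + L) C L))
    ≡⟨ sumBelow-+ (suc i) (λ c → (c + L) C L) (λ c → (i ∸ c) * ((c + L) C L)) ⟩
  sumBelow (suc i) (λ c → (c + L) C L) + sumBelow (suc i) (λ c → (i ∸ c) * ((c + L) C L))
    ≡⟨ cong₂ _+_ (hockey-stick i L) (weighted-hockey-stick i L) ⟩
  suc (i + L) C suc L + suc (i + L) C suc (suc L)
    ≡⟨ nCk+nC[k+1]≡[n+1]C[k+1] (suc (i + L)) (suc L) ⟩
  suc (suc i + L) C suc (suc L) ∎

threshold-weighted-sum : ∀ i L → sumBelow (suc i) (λ t → t * ((i + L ∸ t) C L)) ≡ suc (i + L) C suc (suc L)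
threshold-weighted-sum i L = begin
  sumBelow (suc i) (λ t → t * ((i + L ∸ t) C L))                ≡⟨ sumBelow-reverse (suc i) _ ⟩
  sumBelow (suc i) (λ c → (i ∸ c) * ((i + L ∸ (i ∸ c)) C L))    ≡⟨ sumBelow-cong (suc i) (λ c c≤i →
                                                                      cong (λ z → (i ∸ c) * (z C L)) (complement c (≤-pred c≤i))) ⟩
  sumBelow (suc i) (λ c → (i ∸ c) * ((c + L) C L))              ≡⟨ weighted-hockey-stick i L ⟩
  suc (i + L) C suc (suc L)                                     ∎
  where
  complement : ∀ c → c ≤ i → i + L ∸ (i ∸ c) ≡ c + L
  complement c c≤i = begin
    i + L ∸ (i ∸ c)               ≡⟨ cong (λ z → z + L ∸ (i ∸ c)) (sym (m∸n+n≡m c≤i)) ⟩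
    (i ∸ c) + c + L ∸ (i ∸ c)     ≡⟨ cong (_∸ (i ∸ c)) (+-assoc (i ∸ c) c L) ⟩
    (i ∸ c) + (c + L) ∸ (i ∸ c)   ≡⟨ m+n∸m≡n (i ∸ c) (c + L) ⟩
    c + L                         ∎

α-factorial : ∀ i d → α i d * (suc i) ! ≡ (suc (i + d)) !
α-factorial i zero    = trans (*-identityˡ _) (cong (λ z → suc z !) (sym (+-identityʳ i)))
α-factorial i (suc d) = begin
  suc (suc (i + d)) * α i d * (suc i) !    ≡⟨ *-assoc (suc (suc (i + d))) (α i d) ((suc i) !) ⟩
  suc (suc (i + d)) * (α i d * (suc i) !)  ≡⟨ cong (suc (suc (i + d)) *_) (α-factorial i d) ⟩
  suc (suc (i + d)) !                      ≡⟨ cong (λ z → suc z !) (sym (+-suc i d)) ⟩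
  suc (i + suc d) !                        ∎

α-binomial : ∀ i d → suc (suc (i + d)) * α i d ≡ (suc d) ! * (suc (suc (i + d)) C suc i)
α-binomial i d =
  *-cancelʳ-≡ (N * α i d) ((suc d) ! * (N C suc i)) ((suc i) !) {{suc i !≢0}} (begin
    N * α i d * (suc i) !                    ≡⟨ *-assoc N (α i d) ((suc i) !) ⟩
    N * (α i d * (suc i) !)                  ≡⟨ cong (N *_) (α-factorial i d) ⟩
    N !                                      ≡⟨ sym (binomial-factorials {N} {suc i} (s≤s (≤-trans (m≤m+n i d) (n≤1+n _)))) ⟩
    (N C suc i) * ((suc i) ! * (N ∸ suc i) !) ≡⟨ cong (λ z → (N C suc i) * ((suc i) ! * z !)) gap ⟩
    (N C suc i) * ((suc i) ! * (suc d) !)    ≡⟨ regroup (N C suc i) ((suc i) !) ((suc d) !) ⟩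
    (suc d) ! * (N C suc i) * (suc i) !      ∎)
  where
  N = suc (suc (i + d))
  gap : N ∸ suc i ≡ suc d
  gap = trans (cong (_∸ i) (sym (+-suc i d))) (m+n∸m≡n i (suc d))
  regroup : ∀ a b c → a * (b * c) ≡ c * a * b
  regroup = solve-∀

β-binomial : ∀ i d t → t ≤ i → β i d t ≡ (suc d) ! * ((suc (i + d) ∸ t) C (suc d))
β-binomial i zero    t t≤i =
  sym (trans (+-identityʳ _) (trans (nC1≡n _) (cong (λ z → suc z ∸ t) (+-identityʳ i))))
β-binomial i (suc d) t t≤i = begin
  (suc (suc (i + d)) ∸ t) * β i d t                ≡⟨ cong₂ _*_ (+-∸-assoc 1 t≤) (β-binomial i d t t≤i) ⟩
  suc X * ((suc d) ! * (X C suc d))                ≡⟨ swap (suc X) ((suc d) !) (X C suc d) ⟩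
  (suc d) ! * (suc X * (X C suc d))                ≡⟨ cong ((suc d) ! *_) (absorption X (suc d)) ⟩
  (suc d) ! * (suc (suc d) * (suc X C suc (suc d))) ≡⟨ regroup ((suc d) !) (suc (suc d)) _ ⟩
  (suc (suc d)) ! * (suc X C suc (suc d))          ≡⟨ cong (λ z → (suc (suc d)) ! * (z C suc (suc d))) (sym (+-∸-assoc 1 t≤)) ⟩
  (suc (suc d)) ! * ((suc (suc (i + d)) ∸ t) C suc (suc d))
                                                   ≡⟨ cong (λ z → (suc (suc d)) ! * ((suc z ∸ t) C suc (suc d))) (sym (+-suc i d)) ⟩
  (suc (suc d)) ! * ((suc (i + suc d) ∸ t) C suc (suc d)) ∎
  where
  X = suc (i + d) ∸ t
  t≤ : t ≤ suc (i + d)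
  t≤ = ≤-trans t≤i (≤-trans (m≤m+n i d) (n≤1+n _))
  swap : ∀ a b c → a * (b * c) ≡ b * (a * c)
  swap = solve-∀
  regroup : ∀ a b c → a * (b * c) ≡ b * a * c
  regroup = solve-∀

rhsTerm : ℕ → ℕ → ℕ
rhsTerm n i = κ i * (((n ∸ i ∸ 1) !) ^ 2) * (n C (i + 1)) * (n C (i ∸ 1))

rhs-sumBelow : ∀ m → rhs (suc m) ≡ sumBelow m (λ j → rhsTerm (suc m) (suc j))
rhs-sumBelow m = sumOver-applyUpTo m suc (rhsTerm (suc m))

transfer-kernel-threshold : ∀ N t → t ≤ N → transfer N kernelIndicator (threshold (suc t)) ≡ N * t
transfer-kernel-threshold N t t≤N = begin
  transfer N kernelIndicator (threshold (suc t))  ≡⟨ transfer-threshold N kernelIndicator t ⟩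
  N * ((t ⊓ N) * 1 + (N ∸ t) * 0)                 ≡⟨ cong (λ z → N * (z * 1 + (N ∸ t) * 0)) (m≤n⇒m⊓n≡m t≤N) ⟩
  N * (t * 1 + (N ∸ t) * 0)                       ≡⟨ simplify N t (N ∸ t) ⟩
  N * t                                           ∎
  where
  simplify : ∀ n t q → n * (t * 1 + q * 0) ≡ n * t
  simplify = solve-∀

contribution-kernel : ∀ i d → let N = suc (suc (i + d)) in
  contribution i d (λ t → transfer N kernelIndicator (threshold t)) ≡ (N * α i d) * ((suc d) ! * (N C suc (suc (suc d))))
contribution-kernel i d = begin
  contribution i d (λ t → transfer N kernelIndicator (threshold t))
    ≡⟨ sumBelow-cong (suc i) (λ t t≤i → summand t (≤-pred t≤i)) ⟩
  sumBelow (suc i) (λ t → (N * α i d) * ((suc d) ! * (t * ((i + suc d ∸ t) C suc d))))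
    ≡⟨ sumBelow-* (suc i) (N * α i d) _ ⟩
  (N * α i d) * sumBelow (suc i) (λ t → (suc d) ! * (t * ((i + suc d ∸ t) C suc d)))
    ≡⟨ cong ((N * α i d) *_) (sumBelow-* (suc i) ((suc d) !) _) ⟩
  (N * α i d) * ((suc d) ! * sumBelow (suc i) (λ t → t * ((i + suc d ∸ t) C suc d)))
    ≡⟨ cong (λ z → (N * α i d) * ((suc d) ! * z)) (threshold-weighted-sum i (suc d)) ⟩
  (N * α i d) * ((suc d) ! * (suc (i + suc d) C suc (suc (suc d))))
    ≡⟨ cong (λ z → (N * α i d) * ((suc d) ! * (suc z C suc (suc (suc d))))) (+-suc i d) ⟩
  (N * α i d) * ((suc d) ! * (N C suc (suc (suc d)))) ∎
  where
  N = suc (suc (i + d))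
  regroup : ∀ a f c n t → a * (f * c) * (n * t) ≡ n * a * (f * (t * c))
  regroup = solve-∀
  summand : ∀ t → t ≤ i → α i d * β i d t * transfer N kernelIndicator (threshold (suc t))
                        ≡ (N * α i d) * ((suc d) ! * (t * ((i + suc d ∸ t) C suc d)))
  summand t t≤i = begin
    α i d * β i d t * transfer N kernelIndicator (threshold (suc t))
      ≡⟨ cong₂ (λ b x → α i d * b * x) (β-binomial i d t t≤i)
               (transfer-kernel-threshold N t (≤-trans t≤i (≤-trans (m≤m+n i d) (≤-trans (n≤1+n _) (n≤1+n _))))) ⟩
    α i d * ((suc d) ! * ((suc (i + d) ∸ t) C suc d)) * (N * t)
      ≡⟨ regroup (α i d) ((suc d) !) _ N t ⟩
    (N * α i d) * ((suc d) ! * (t * ((suc (i + d) ∸ t) C suc d)))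
      ≡⟨ cong (λ z → (N * α i d) * ((suc d) ! * (t * ((z ∸ t) C suc d)))) (sym (+-suc i d)) ⟩
    (N * α i d) * ((suc d) ! * (t * ((i + suc d ∸ t) C suc d))) ∎

-- An older kernel position (rank j+1, with d+1 further steps) gives the summand i = j+1.
contribution-term : ∀ j d → let N = suc (suc (suc j + d)) in
  κ (suc j) * contribution (suc j) d (λ t → transfer N kernelIndicator (threshold t)) ≡ rhsTerm N (suc j)
contribution-term j d = begin
  κ (suc j) * contribution i d u
    ≡⟨ cong (κ (suc j) *_) (contribution-kernel i d) ⟩
  κ (suc j) * ((N * α i d) * (L ! * (N C suc (suc L))))
    ≡⟨ cong (λ z → κ (suc j) * (z * (L ! * (N C suc (suc L))))) (α-binomial i d) ⟩
  κ (suc j) * ((L ! * (N C suc i)) * (L ! * (N C suc (suc L))))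
    ≡⟨ cong₂ (λ a b → κ (suc j) * ((L ! * (N C a)) * (L ! * b))) (+-comm 1 i) (sym symmetric) ⟩
  κ (suc j) * ((L ! * (N C (i + 1))) * (L ! * (N C j)))
    ≡⟨ regroup (κ (suc j)) (L !) (N C (i + 1)) (N C j) ⟩
  κ (suc j) * (L !) ^ 2 * (N C (i + 1)) * (N C j)
    ≡⟨ cong (λ z → κ (suc j) * (z !) ^ 2 * (N C (i + 1)) * (N C j)) (sym (gap j)) ⟩
  rhsTerm N (suc j) ∎
  where
  i = suc j
  L = suc d
  N = suc (suc (suc j + d))
  u = λ t → transfer N kernelIndicator (threshold t)
  regroup : ∀ k f a b → k * ((f * a) * (f * b)) ≡ k * (f * (f * 1)) * a * b
  regroup = solve-∀
  gap : ∀ j → suc (suc (suc j + d)) ∸ suc j ∸ 1 ≡ suc d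
  gap zero    = refl
  gap (suc j) = gap j
  complement : N ∸ j ≡ suc (suc L)
  complement = trans (cong (_∸ j) (shape j d)) (m+n∸m≡n j (suc (suc L)))
    where
    shape : ∀ j d → suc (suc (suc j + d)) ≡ j + suc (suc (suc d))
    shape = solve-∀
  symmetric : N C j ≡ N C suc (suc L)
  symmetric = trans (nCk≡nC[n∸k] {j} {N} (≤-trans (n≤1+n j) (≤-trans (m≤m+n (suc j) d) (≤-trans (n≤1+n _) (n≤1+n _)))))
                    (cong (N C_) complement)

older-term : ∀ m j → j < m →
  κ (suc j) * contribution (suc j) (m ∸ suc j) (λ t → transfer (suc (suc m)) kernelIndicator (threshold t)) ≡ rhsTerm (suc (suc m)) (suc j)
older-term m j j<m with m ∸ suc j | m+[n∸m]≡n j<m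
... | d | refl = contribution-term j d

-- The newest kernel positions (rank m+1) give the summand i = m+1, namely C(m+2,2) κ_{m+1}.
newest-term : ∀ m → transfer (suc (suc m)) kernelIndicator kernel * κ (suc m) ≡ rhsTerm (suc (suc m)) (suc m)
newest-term m = begin
  transfer M kernelIndicator kernel * κ (suc m)
    ≡⟨ cong (_* κ (suc m)) (transfer-kernel M kernelIndicator) ⟩
  sumBelow M (λ a → (a ⊓ M) * 1 + (M ∸ a) * 0) * κ (suc m)
    ≡⟨ cong (_* κ (suc m)) (sumBelow-cong M (λ a a<M →
         trans (cong (λ z → z * 1 + (M ∸ a) * 0) (m≤n⇒m⊓n≡m (<⇒≤ a<M))) (simplify a (M ∸ a)))) ⟩
  sumBelow M (λ a → a) * κ (suc m)
    ≡⟨ cong (_* κ (suc m)) (triangular M) ⟩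
  (M C 2) * κ (suc m)
    ≡⟨ cong (_* κ (suc m)) (sym symmetric) ⟩
  (M C m) * κ (suc m)
    ≡⟨ regroup (M C m) (κ (suc m)) ⟩
  κ (suc m) * ((0 !) ^ 2) * 1 * (M C m)
    ≡⟨ cong₂ (λ a b → κ (suc m) * ((a !) ^ 2) * b * (M C m))
             (sym (gap m)) (sym (trans (cong (M C_) (+-comm (suc m) 1)) (nCn≡1 M))) ⟩
  rhsTerm M (suc m) ∎
  where
  M = suc (suc m)
  simplify : ∀ a q → a * 1 + q * 0 ≡ a
  simplify = solve-∀
  regroup : ∀ c k → c * k ≡ k * (1 * (1 * 1)) * 1 * c
  regroup = solve-∀
  gap : ∀ m → suc (suc m) ∸ suc m ∸ 1 ≡ 0
  gap zero    = refl
  gap (suc m) = gap m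
  symmetric : M C m ≡ M C 2
  symmetric = trans (nCk≡nC[n∸k] {m} {M} (≤-trans (n≤1+n m) (n≤1+n _)))
                    (cong (M C_) (trans (cong (_∸ m) (+-comm 2 m)) (m+n∸m≡n m 2)))

proposition3p7 : (n : ℕ) → 2 ≤ n → κ n ≡ rhs n
proposition3p7 (suc (suc m)) (s≤s (s≤s z≤n)) = begin
  κ M
    ≡⟨ κ-stateSum M ⟩
  stateSum M kernelIndicator
    ≡⟨ stateSum-split m kernelIndicator ⟩
  transfer M kernelIndicator kernel * κ (suc m) + thresholdSum (suc m) u
    ≡⟨ cong (transfer M kernelIndicator kernel * κ (suc m) +_) (thresholdSum-unrolled m u) ⟩
  transfer M kernelIndicator kernel * κ (suc m) + sumBelow m (λ j → κ (suc j) * contribution (suc j) (m ∸ suc j) u)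
    ≡⟨ +-comm (transfer M kernelIndicator kernel * κ (suc m)) _ ⟩
  sumBelow m (λ j → κ (suc j) * contribution (suc j) (m ∸ suc j) u) + transfer M kernelIndicator kernel * κ (suc m)
    ≡⟨ cong₂ _+_ (sumBelow-cong m (older-term m)) (newest-term m) ⟩
  sumBelow (suc m) (λ j → rhsTerm M (suc j))
    ≡⟨ sym (rhs-sumBelow (suc m)) ⟩
  rhs M ∎
  where
  M = suc (suc m)
  u = λ t → transfer M kernelIndicator (threshold t)
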